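{- Up to isomorphism there is exactly one $4$-cycle bitrade of volume $3$ and foundation $6$. Moreover, this bitrade can be extended to two $3$-way $4$-cycle trades, i.e. there are two $3$-way $4$-cycle trades $\{T_1,T_2,T_3\}$ containing the two sides $T_1,T_2$ of this bitrade.
   Context: A $4$-cycle $abcd$ consists of four distinct vertices and edges $\{a,b\},\{b,c\},\{c,d\},\{d,a\}$; $4$-cycles are identified with their edge sets. A set $T_1$ of pairwise edge-disjoint $4$-cycles on a vertex set is a $4$-cycle trade if there is a set $T_2$ of pairwise edge-disjoint $4$-cycles on the same vertex set with $T_1\cap T_2=\emptyset$ and $\bigcup_{C\in T_1}E(C)=\bigcup_{C\in T_2}E(C)$; $(T_1,T_2)$ is a $4$-cycle bitrade of volume $|T_1|$ and foundation equal to the number of vertices covered by the cycles of $T_1$. A $\mu$-way $4$-cycle trade is a collection of $\mu$ pairwise disjoint sets $\{T_1,\dots,T_\mu\}$ of $4$-cycles such that $(T_i,T_j)$ is a $4$-cycle bitrade for every $i\neq j$. Two bitrades are isomorphic if a bijection between their vertex sets maps one to the other. -}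

module Defs where

open import Data.Nat using (ℕ; _≟_)
open import Data.Product using (Σ; _×_; _,_)
open import Data.Sum using (_⊎_)
open import Data.List using (List; []; _∷_; map; concatMap; length; deduplicate)
open import Data.List.Relation.Unary.All using (All)
open import Data.List.Relation.Unary.Any using (Any)
open import Data.List.Relation.Unary.AllPairs using (AllPairs)
open import Data.List.Membership.Propositional using (_∈_)
open import Relation.Nullary using (¬_)
open import Relation.Binary.PropositionalEquality using (_≡_)

-- Vertices are natural numbers (any finite vertex set can be relabelled into ℕ;
-- isomorphism below is invariant under relabelling).
Vertex : Set
Vertex = ℕ

-- An edge {x,y}, given by an ordered pair; equality of edges is unordered.
Edge : Set
Edge = Vertex × Vertex

SameEdge : Edge → Edge → Set
SameEdge (a , b) (c , d) = (a ≡ c × b ≡ d) ⊎ (a ≡ d × b ≡ c)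

-- A 4-cycle abcd, given by its four vertices in cyclic order.
record Cycle4 : Set where
  constructor cyc
  field
    a b c d : Vertex

open Cycle4 public

IsCycle4 : Cycle4 → Set
IsCycle4 C =
  ¬ (a C ≡ b C) × ¬ (a C ≡ c C) × ¬ (a C ≡ d C) ×
  ¬ (b C ≡ c C) × ¬ (b C ≡ d C) × ¬ (c C ≡ d C)

edgesOf : Cycle4 → List Edge
edgesOf C = (a C , b C) ∷ (b C , c C) ∷ (c C , d C) ∷ (d C , a C) ∷ []

verticesOf : Cycle4 → List Vertex
verticesOf C = a C ∷ b C ∷ c C ∷ d C ∷ []

_∈E_ : Edge → Cycle4 → Set
e ∈E C = Any (SameEdge e) (edgesOf C)

-- 4-cycles are identified with their edge sets
SameCycle : Cycle4 → Cycle4 → Set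
SameCycle C D = (∀ e → e ∈E C → e ∈E D) × (∀ e → e ∈E D → e ∈E C)

EdgeDisjoint : Cycle4 → Cycle4 → Set
EdgeDisjoint C D = ∀ e → e ∈E C → ¬ (e ∈E D)

Family : Set
Family = List Cycle4

-- A set of pairwise edge-disjoint 4-cycles (edge-disjointness of distinct list
-- entries also forces the entries to be distinct cycles, so the list is a set).
EdgeDisjointFamily : Family → Set
EdgeDisjointFamily T = All IsCycle4 T × AllPairs EdgeDisjoint T

_∈C_ : Cycle4 → Family → Set
C ∈C T = Any (SameCycle C) T

SameFamily : Family → Family → Set
SameFamily T S = (∀ C → C ∈C T → C ∈C S) × (∀ C → C ∈C S → C ∈C T)

_∈U_ : Edge → Family → Set
e ∈U T = Any (e ∈E_) T

Bitrade : Family → Family → Set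
Bitrade T₁ T₂ =
  EdgeDisjointFamily T₁ × EdgeDisjointFamily T₂ ×
  All (λ C → ¬ (C ∈C T₂)) T₁ ×
  (∀ e → (e ∈U T₁ → e ∈U T₂) × (e ∈U T₂ → e ∈U T₁))

volume : Family → ℕ
volume T = length T

verticesOfFamily : Family → List Vertex
verticesOfFamily T = concatMap verticesOf T

foundation : Family → ℕ
foundation T = length (deduplicate _≟_ (verticesOfFamily T))

mapCycle : (Vertex → Vertex) → Cycle4 → Cycle4
mapCycle f C = cyc (f (a C)) (f (b C)) (f (c C)) (f (d C))

mapFamily : (Vertex → Vertex) → Family → Family
mapFamily f T = map (mapCycle f) T

InjectiveOn : (Vertex → Vertex) → List Vertex → Set
InjectiveOn f vs = ∀ x y → x ∈ vs → y ∈ vs → f x ≡ f y → x ≡ y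

-- (T₁ , T₂) ≅ (S₁ , S₂): a bijection f from the vertex set of the first bitrade
-- onto that of the second (f injective on the covered vertices; surjectivity onto
-- the covered vertices of S₁ follows from f(T₁) = S₁) mapping T₁ to S₁ and T₂ to S₂.
Isomorphic : Family → Family → Family → Family → Set
Isomorphic T₁ T₂ S₁ S₂ =
  Σ (Vertex → Vertex) λ f →
    InjectiveOn f (verticesOfFamily T₁) ×
    SameFamily (mapFamily f T₁) S₁ ×
    SameFamily (mapFamily f T₂) S₂

-- {T₁ , T₂ , T₃} is a 3-way 4-cycle trade: (Tᵢ , Tⱼ) is a bitrade for all i ≠ j
-- (which includes pairwise disjointness of the Tᵢ).
ThreeWayTrade : Family → Family → Family → Set
ThreeWayTrade T₁ T₂ T₃ =
  Bitrade T₁ T₂ × Bitrade T₂ T₁ × Bitrade T₁ T₃ ×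
  Bitrade T₃ T₁ × Bitrade T₂ T₃ × Bitrade T₃ T₂

Bitrade36 : Family → Family → Set
Bitrade36 T₁ T₂ = Bitrade T₁ T₂ × volume T₁ ≡ 3 × foundation T₁ ≡ 6

-- Relabel the six covered vertices of T₁ as 0, …, 5.  Three edge-disjoint 4-cycles on
-- six vertices use twelve of the fifteen edges of K₆ and leave every degree even, so the
-- three missing edges form a perfect matching and the cycles decompose an octahedron.
-- An exhaustive enumeration of packings of 4-cycles shows that, up to relabelling, the
-- octahedron has two such decompositions: its three equators, which share a cycle with
-- every other decomposition, and modelT₁, whose partners are all carried onto modelT₂
-- by symmetries of modelT₁.  The same enumeration finds exactly two decompositions
-- avoiding both modelT₁ and modelT₂, which are pulled back to the two third trades.
{-# OPTIONS --safe #-}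
module Submission where

open import Defs
open import Data.Bool using (Bool; true; false; if_then_else_)
open import Data.Empty using (⊥-elim)
open import Data.List using (List; []; _∷_; map; concatMap; length; filter; _++_; reverse; deduplicate; upTo)
open import Data.List.Properties using (map-∘; map-id-local; length-map; filter-notAll)
open import Data.List.Relation.Unary.All as All using (All; []; _∷_)
import Data.List.Relation.Unary.All.Properties as All
open import Data.List.Relation.Unary.Any as Any using (Any; here; there)
import Data.List.Relation.Unary.Any.Properties as Any
open import Data.List.Relation.Unary.AllPairs as AllPairs using (AllPairs; []; _∷_)
open import Data.List.Relation.Unary.Unique.Propositional using (Unique)
open import Data.List.Membership.Propositional using (_∈_; lose; find)
open import Data.List.Membership.Propositional.Properties
  using (∈-map⁺; ∈-filter⁺; ∈-concatMap⁺; ∈-deduplicate⁺; ∈-deduplicate⁻; ∈-upTo⁺)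
open import Data.Nat using (ℕ; zero; suc; _≟_; _<_; _≤_; z≤n; s≤s; s≤s⁻¹; _+_; _*_; _<ᵇ_; _<?_; _≡ᵇ_)
open import Data.List.Relation.Unary.Unique.DecPropositional.Properties _≟_ using (deduplicate-!)
open import Data.Nat.Properties using (≤-refl; <-≤-trans)
open import Data.Product using (Σ; _×_; _,_; proj₁; proj₂; uncurry)
open import Data.Sum using (_⊎_; inj₁; inj₂)
import Data.Sum as Sum
open import Function using (_∘_)
open import Relation.Binary.PropositionalEquality using (_≡_; refl; sym; trans; cong; subst; subst₂)
open import Relation.Nullary using (¬_; Dec; yes; no; does; ¬?)
open import Relation.Nullary.Decidable using (_×-dec_; _⊎-dec_; map′; _→-dec_; from-yes; from-no)

sameEdge-refl : ∀ e → SameEdge e e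
sameEdge-refl _ = inj₁ (refl , refl)

sameEdge-sym : ∀ {e f} → SameEdge e f → SameEdge f e
sameEdge-sym (inj₁ (p , q)) = inj₁ (sym p , sym q)
sameEdge-sym (inj₂ (p , q)) = inj₂ (sym q , sym p)

sameEdge-trans : ∀ {e f g} → SameEdge e f → SameEdge f g → SameEdge e g
sameEdge-trans (inj₁ (p , q)) (inj₁ (r , s)) = inj₁ (trans p r , trans q s)
sameEdge-trans (inj₁ (p , q)) (inj₂ (r , s)) = inj₂ (trans p r , trans q s)
sameEdge-trans (inj₂ (p , q)) (inj₁ (r , s)) = inj₂ (trans p s , trans q r)
sameEdge-trans (inj₂ (p , q)) (inj₂ (r , s)) = inj₁ (trans p s , trans q r)

sameEdge-swap : ∀ {e} x y → SameEdge e (x , y) → SameEdge e (y , x)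
sameEdge-swap x y s = sameEdge-trans s (inj₂ (refl , refl))

∈E-resp : ∀ C {e f} → SameEdge e f → f ∈E C → e ∈E C
∈E-resp C s = Any.map (sameEdge-trans s)

∈U-resp : ∀ T {e f} → SameEdge e f → f ∈U T → e ∈U T
∈U-resp T s = Any.map (∈E-resp _ s)

_⊆E_ : Cycle4 → Cycle4 → Set
C ⊆E D = ∀ e → e ∈E C → e ∈E D

_⊆C_ : Family → Family → Set
T ⊆C S = ∀ C → C ∈C T → C ∈C S

_⊆U_ : Family → Family → Set
T ⊆U S = ∀ e → e ∈U T → e ∈U S

sameCycle-refl : ∀ C → SameCycle C C
sameCycle-refl C = (λ _ x → x) , (λ _ x → x)

sameCycle-sym : ∀ {C D} → SameCycle C D → SameCycle D C
sameCycle-sym (p , q) = q , p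

sameCycle-trans : ∀ {C D E} → SameCycle C D → SameCycle D E → SameCycle C E
sameCycle-trans (p , q) (r , s) = (λ e x → r e (p e x)) , (λ e x → q e (s e x))

∈C-resp : ∀ T {C D} → SameCycle C D → D ∈C T → C ∈C T
∈C-resp T s = Any.map (sameCycle-trans s)

sameFamily-sym : ∀ {T S} → SameFamily T S → SameFamily S T
sameFamily-sym (p , q) = q , p

sameFamily-trans : ∀ {T S R} → SameFamily T S → SameFamily S R → SameFamily T R
sameFamily-trans (p , q) (r , s) = (λ C x → r C (p C x)) , (λ C x → q C (s C x))

sameFamily⇒⊆U : ∀ {T S} → SameFamily T S → T ⊆U S
sameFamily⇒⊆U (T⊆S , _) e e∈T with C , C∈T , e∈C ← find e∈T
  with D , D∈S , C≈D ← find (T⊆S C (lose C∈T (sameCycle-refl C)))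
  = lose D∈S (proj₁ C≈D e e∈C)

module _ {A : Set} {R : A → A → Set} {Q : A → Set} where

  lookup≈ : (∀ {x y} → R x y → Q y → Q x) → ∀ {x xs} → All Q xs → Any (R x) xs → Q x
  lookup≈ resp qs i = let q , r = All.lookupAny qs i in resp r q

  tabulate≈ : (∀ x → R x x) → ∀ {xs} → (∀ {x} → Any (R x) xs → Q x) → All Q xs
  tabulate≈ refl′ f = All.tabulate (λ x∈xs → f (lose x∈xs (refl′ _)))

sameEdge? : (e f : Edge) → Dec (SameEdge e f)
sameEdge? (x , y) (u , v) = ((x ≟ u) ×-dec (y ≟ v)) ⊎-dec ((x ≟ v) ×-dec (y ≟ u))

_∈E?_ : (e : Edge) (C : Cycle4) → Dec (e ∈E C)
e ∈E? C = Any.any? (sameEdge? e) (edgesOf C)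

_∈U?_ : (e : Edge) (T : Family) → Dec (e ∈U T)
e ∈U? T = Any.any? (e ∈E?_) T

all∈E? : {Q : Edge → Set} → (∀ {e f} → SameEdge e f → Q f → Q e) → (∀ e → Dec (Q e)) →
         (C : Cycle4) → Dec (∀ e → e ∈E C → Q e)
all∈E? resp Q? C = map′ (λ qs _ → lookup≈ resp qs) (λ q → tabulate≈ sameEdge-refl (q _))
  (All.all? Q? (edgesOf C))

_⊆E?_ : (C D : Cycle4) → Dec (C ⊆E D)
C ⊆E? D = all∈E? (∈E-resp D) (_∈E? D) C

sameCycle? : (C D : Cycle4) → Dec (SameCycle C D)
sameCycle? C D = (C ⊆E? D) ×-dec (D ⊆E? C)

_∈C?_ : (C : Cycle4) (T : Family) → Dec (C ∈C T)
C ∈C? T = Any.any? (sameCycle? C) T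

_⊆C?_ : (T S : Family) → Dec (T ⊆C S)
T ⊆C? S = map′ (λ qs _ → lookup≈ (∈C-resp S) qs) (λ q → tabulate≈ sameCycle-refl (q _))
  (All.all? (_∈C? S) T)

sameFamily? : (T S : Family) → Dec (SameFamily T S)
sameFamily? T S = (T ⊆C? S) ×-dec (S ⊆C? T)

_⊆U?_ : (T S : Family) → Dec (T ⊆U S)
T ⊆U? S = map′ (λ qs e e∈T → let C , C∈T , e∈C = find e∈T in All.lookup qs C∈T e e∈C)
  (λ T⊆S → All.tabulate (λ C∈T e e∈C → T⊆S e (lose C∈T e∈C)))
  (All.all? (all∈E? (∈U-resp S) (_∈U? S)) T)

edgeDisjoint? : (C D : Cycle4) → Dec (EdgeDisjoint C D)
edgeDisjoint? C D =
  all∈E? (λ s e∉D e∈D → e∉D (∈E-resp D (sameEdge-sym s) e∈D)) (λ e → ¬? (e ∈E? D)) C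

isCycle4? : (C : Cycle4) → Dec (IsCycle4 C)
isCycle4? (cyc a b c d) = ¬? (a ≟ b) ×-dec ¬? (a ≟ c) ×-dec ¬? (a ≟ d) ×-dec
  ¬? (b ≟ c) ×-dec ¬? (b ≟ d) ×-dec ¬? (c ≟ d)

edgeDisjointFamily? : (T : Family) → Dec (EdgeDisjointFamily T)
edgeDisjointFamily? T = All.all? isCycle4? T ×-dec AllPairs.allPairs? edgeDisjoint? T

bitrade? : (T S : Family) → Dec (Bitrade T S)
bitrade? T S = edgeDisjointFamily? T ×-dec edgeDisjointFamily? S ×-dec
  All.all? (λ C → ¬? (C ∈C? S)) T ×-dec
  map′ (λ (T⊆S , S⊆T) e → T⊆S e , S⊆T e) (λ same → proj₁ ∘ same , proj₂ ∘ same)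
    ((T ⊆U? S) ×-dec (S ⊆U? T))

-- Relabelling vertices

mapEdge : (Vertex → Vertex) → Edge → Edge
mapEdge f (x , y) = f x , f y

EdgeOn : (Vertex → Set) → Edge → Set
EdgeOn P (x , y) = P x × P y

CycleOn : (Vertex → Set) → Cycle4 → Set
CycleOn P C = All P (verticesOf C)

FamilyOn : (Vertex → Set) → Family → Set
FamilyOn P T = All (CycleOn P) T

InjectiveWithin : (Vertex → Vertex) → (Vertex → Set) → Set
InjectiveWithin f P = ∀ x y → P x → P y → f x ≡ f y → x ≡ y

edgesOn : ∀ {P} C → CycleOn P C → All (EdgeOn P) (edgesOf C)
edgesOn C (pa ∷ pb ∷ pc ∷ pd ∷ []) = (pa , pb) ∷ (pb , pc) ∷ (pc , pd) ∷ (pd , pa) ∷ []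

FamilyOn-weaken : ∀ {P Q} → (∀ {x} → P x → Q x) → ∀ {T} → FamilyOn P T → FamilyOn Q T
FamilyOn-weaken P⇒Q = All.map (All.map P⇒Q)

FamilyOn-map : ∀ {P Q} f → (∀ {x} → P x → Q (f x)) →
               ∀ {T} → FamilyOn P T → FamilyOn Q (mapFamily f T)
FamilyOn-map f P⇒Qf = All.map⁺ ∘ All.map (All.map⁺ ∘ All.map P⇒Qf)

mapFamily-∘ : ∀ f g T → mapFamily g (mapFamily f T) ≡ mapFamily (g ∘ f) T
mapFamily-∘ f g T = sym (map-∘ T)

mapFamily-id : ∀ h {T} → FamilyOn (λ x → h x ≡ x) T → mapFamily h T ≡ T
mapFamily-id h = map-id-local ∘ All.map mapCycle-id
  where
  mapCycle-id : ∀ {C} → CycleOn (λ x → h x ≡ x) C → mapCycle h C ≡ C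
  mapCycle-id {cyc a b c d} (p ∷ q ∷ r ∷ s ∷ []) rewrite p | q | r | s = refl

module _ (f : Vertex → Vertex) where

  sameEdge-map : ∀ {e e′} → SameEdge e e′ → SameEdge (mapEdge f e) (mapEdge f e′)
  sameEdge-map (inj₁ (p , q)) = inj₁ (cong f p , cong f q)
  sameEdge-map (inj₂ (p , q)) = inj₂ (cong f p , cong f q)

  ∈E-map⁺ : ∀ {e} C → e ∈E C → mapEdge f e ∈E mapCycle f C
  ∈E-map⁺ C = Any.map⁺ ∘ Any.map sameEdge-map

  ∈E-map⁻ : ∀ {e′} C → e′ ∈E mapCycle f C → Σ Edge λ e → e ∈ edgesOf C × SameEdge e′ (mapEdge f e)
  ∈E-map⁻ C = find ∘ Any.map⁻

  ∈U-map⁺ : ∀ {e} T → e ∈U T → mapEdge f e ∈U mapFamily f T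
  ∈U-map⁺ T = Any.map⁺ ∘ Any.map (∈E-map⁺ _)

  ∈U-map⁻ : ∀ {e′} T → e′ ∈U mapFamily f T → Σ Edge λ e → e ∈U T × SameEdge e′ (mapEdge f e)
  ∈U-map⁻ T e′∈fT with C , C∈T , e′∈fC ← find (Any.map⁻ e′∈fT)
    with e , e∈C , e′≈fe ← ∈E-map⁻ C e′∈fC
    = e , lose C∈T (lose e∈C (sameEdge-refl e)) , e′≈fe

  ⊆U-map : ∀ {T S} → T ⊆U S → mapFamily f T ⊆U mapFamily f S
  ⊆U-map {T} {S} T⊆S e′ e′∈fT with e , e∈T , e′≈fe ← ∈U-map⁻ T e′∈fT
    = ∈U-resp (mapFamily f S) e′≈fe (∈U-map⁺ S (T⊆S e e∈T))

  sameCycle-map : ∀ {C D} → SameCycle C D → SameCycle (mapCycle f C) (mapCycle f D)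
  sameCycle-map {C} {D} (C⊆D , D⊆C) = ⊆E-map C D C⊆D , ⊆E-map D C D⊆C
    where
    ⊆E-map : ∀ C D → C ⊆E D → mapCycle f C ⊆E mapCycle f D
    ⊆E-map C D C⊆D e′ e′∈fC with e , e∈C , e′≈fe ← ∈E-map⁻ C e′∈fC
      = ∈E-resp (mapCycle f D) e′≈fe (∈E-map⁺ D (C⊆D e (lose e∈C (sameEdge-refl e))))

  ⊆C-map : ∀ {T S} → T ⊆C S → mapFamily f T ⊆C mapFamily f S
  ⊆C-map {T} {S} T⊆S C′ C′∈fT with D , D∈T , C′≈fD ← find (Any.map⁻ C′∈fT)
    = ∈C-resp (mapFamily f S) C′≈fD
        (Any.map⁺ (Any.map sameCycle-map (T⊆S D (lose D∈T (sameCycle-refl D)))))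

  sameFamily-map : ∀ {T S} → SameFamily T S → SameFamily (mapFamily f T) (mapFamily f S)
  sameFamily-map (T⊆S , S⊆T) = ⊆C-map T⊆S , ⊆C-map S⊆T

  module _ {P : Vertex → Set} (inj : InjectiveWithin f P) where

    sameEdge-unmap : ∀ {e e′} → EdgeOn P e → EdgeOn P e′ →
                     SameEdge (mapEdge f e) (mapEdge f e′) → SameEdge e e′
    sameEdge-unmap (px , py) (pu , pv) (inj₁ (p , q)) = inj₁ (inj _ _ px pu p , inj _ _ py pv q)
    sameEdge-unmap (px , py) (pu , pv) (inj₂ (p , q)) = inj₂ (inj _ _ px pv p , inj _ _ py pu q)

    ∈E-unmap : ∀ {e} D → EdgeOn P e → CycleOn P D → mapEdge f e ∈E mapCycle f D → e ∈E D
    ∈E-unmap D pe pD fe∈fD with e′ , e′∈D , fe≈fe′ ← find (Any.map⁻ fe∈fD)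
      = lose e′∈D (sameEdge-unmap pe (All.lookup (edgesOn D pD) e′∈D) fe≈fe′)

    sameCycle-unmap : ∀ {C D} → CycleOn P C → CycleOn P D →
                      SameCycle (mapCycle f C) (mapCycle f D) → SameCycle C D
    sameCycle-unmap {C} {D} pC pD (fC⊆fD , fD⊆fC) =
      ⊆E-unmap C D pC pD fC⊆fD , ⊆E-unmap D C pD pC fD⊆fC
      where
      ⊆E-unmap : ∀ C D → CycleOn P C → CycleOn P D → mapCycle f C ⊆E mapCycle f D → C ⊆E D
      ⊆E-unmap C D pC pD fC⊆fD e e∈C with e″ , e″∈C , e≈e″ ← find e∈C
        = ∈E-resp D e≈e″ (∈E-unmap D (All.lookup (edgesOn C pC) e″∈C) pD
                            (fC⊆fD _ (∈E-map⁺ C (lose e″∈C (sameEdge-refl e″)))))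

    ∈C-unmap : ∀ {C} T → CycleOn P C → FamilyOn P T → mapCycle f C ∈C mapFamily f T → C ∈C T
    ∈C-unmap T pC pT fC∈fT with D , D∈T , fC≈fD ← find (Any.map⁻ fC∈fT)
      = lose D∈T (sameCycle-unmap pC (All.lookup pT D∈T) fC≈fD)

    isCycle4-map : ∀ {C} → CycleOn P C → IsCycle4 C → IsCycle4 (mapCycle f C)
    isCycle4-map (pa ∷ pb ∷ pc ∷ pd ∷ []) (a≢b , a≢c , a≢d , b≢c , b≢d , c≢d) =
      a≢b ∘ inj _ _ pa pb , a≢c ∘ inj _ _ pa pc , a≢d ∘ inj _ _ pa pd ,
      b≢c ∘ inj _ _ pb pc , b≢d ∘ inj _ _ pb pd , c≢d ∘ inj _ _ pc pd

    edgeDisjoint-map : ∀ {C D} → CycleOn P C → CycleOn P D → EdgeDisjoint C D →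
                       EdgeDisjoint (mapCycle f C) (mapCycle f D)
    edgeDisjoint-map {C} {D} pC pD disj e′ e′∈fC e′∈fD with e , e∈C , e′≈fe ← ∈E-map⁻ C e′∈fC
      = disj e (lose e∈C (sameEdge-refl e)) (∈E-unmap D (All.lookup (edgesOn C pC) e∈C) pD
          (∈E-resp (mapCycle f D) (sameEdge-sym e′≈fe) e′∈fD))

    edgeDisjointFamily-map : ∀ {T} → FamilyOn P T → EdgeDisjointFamily T →
                             EdgeDisjointFamily (mapFamily f T)
    edgeDisjointFamily-map pT (cycles , disjoint) =
      All.map⁺ (All.zipWith (λ (pC , C) → isCycle4-map pC C) (pT , cycles)) , pairwise pT disjoint
      where
      pairwise : ∀ {T} → FamilyOn P T → AllPairs EdgeDisjoint T → AllPairs EdgeDisjoint (mapFamily f T)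
      pairwise [] [] = []
      pairwise (pC ∷ pT) (disjC ∷ disjT) =
        All.map⁺ (All.zipWith (λ (pD , CD) → edgeDisjoint-map pC pD CD) (pT , disjC)) ∷ pairwise pT disjT

    notIn-map : ∀ {T S} → FamilyOn P T → FamilyOn P S → All (λ C → ¬ C ∈C S) T →
                All (λ C → ¬ C ∈C mapFamily f S) (mapFamily f T)
    notIn-map {S = S} pT pS notIn =
      All.map⁺ (All.zipWith (λ (pC , C∉S) fC∈fS → C∉S (∈C-unmap S pC pS fC∈fS)) (pT , notIn))

    bitrade-map : ∀ {T S} → FamilyOn P T → FamilyOn P S → Bitrade T S →
                  Bitrade (mapFamily f T) (mapFamily f S)
    bitrade-map pT pS (edfT , edfS , notIn , same) =
      edgeDisjointFamily-map pT edfT , edgeDisjointFamily-map pS edfS , notIn-map pT pS notIn ,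
      λ e → ⊆U-map (proj₁ ∘ same) e , ⊆U-map (proj₂ ∘ same) e

sameFamily-∘ : ∀ {T X A} f g → SameFamily (mapFamily f T) X → SameFamily (mapFamily g X) A →
               SameFamily (mapFamily (g ∘ f) T) A
sameFamily-∘ {T} {A = A} f g fT≈X gX≈A =
  subst (λ Y → SameFamily Y A) (mapFamily-∘ f g T) (sameFamily-trans (sameFamily-map g fT≈X) gX≈A)

bitrade-notIn⁻ : ∀ {T S} → Bitrade T S → All (λ D → ¬ D ∈C T) S
bitrade-notIn⁻ (_ , _ , T∉S , _) = All.tabulate λ D∈S D∈T →
  let C , C∈T , D≈C = find D∈T in All.lookup T∉S C∈T (lose D∈S (sameCycle-sym D≈C))

bitrade-sym : ∀ {T S} → Bitrade T S → Bitrade S T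
bitrade-sym bitrade@(edfT , edfS , _ , same) =
  edfS , edfT , bitrade-notIn⁻ bitrade , λ e → proj₂ (same e) , proj₁ (same e)

bitrade-congˡ : ∀ {T T′ S} → EdgeDisjointFamily T → SameFamily T T′ → Bitrade T′ S → Bitrade T S
bitrade-congˡ {T} {T′} {S} edfT T≈T′ (_ , edfS , T′∉S , same) = edfT , edfS , T∉S , same′
  where
  T∉S : All (λ C → ¬ C ∈C S) T
  T∉S = All.tabulate λ {C} C∈T C∈S →
    let D , D∈T′ , C≈D = find (proj₁ T≈T′ C (lose C∈T (sameCycle-refl C))) in
    All.lookup T′∉S D∈T′ (∈C-resp S (sameCycle-sym C≈D) C∈S)
  same′ : ∀ e → (e ∈U T → e ∈U S) × (e ∈U S → e ∈U T)
  same′ e = (λ e∈T → proj₁ (same e) (sameFamily⇒⊆U T≈T′ e e∈T)) ,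
            (λ e∈S → sameFamily⇒⊆U (sameFamily-sym T≈T′) e (proj₂ (same e) e∈S))

bitrade-⊇U : ∀ {T S} → Bitrade T S → S ⊆U T
bitrade-⊇U (_ , _ , _ , same) e = proj₂ (same e)

VertexOf : Family → Vertex → Set
VertexOf T x = x ∈ verticesOfFamily T

⊆U⇒FamilyOn : ∀ {T S} → T ⊆U S → FamilyOn (VertexOf S) T
⊆U⇒FamilyOn {T} {S} T⊆S = All.tabulate λ C∈T → cycleOn λ e e∈C → T⊆S e (lose C∈T e∈C)
  where
  tail∈ : ∀ {x y} → (x , y) ∈U S → VertexOf S x
  tail∈ xy∈S with C , C∈S , xy∈C ← find xy∈S = ∈-concatMap⁺ verticesOf (lose C∈S (tail∈C _ xy∈C))
    where
    tail∈C : ∀ {x y} C → (x , y) ∈E C → x ∈ verticesOf C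
    tail∈C _ (here (inj₁ (p , _))) = here p
    tail∈C _ (here (inj₂ (p , _))) = there (here p)
    tail∈C _ (there (here (inj₁ (p , _)))) = there (here p)
    tail∈C _ (there (here (inj₂ (p , _)))) = there (there (here p))
    tail∈C _ (there (there (here (inj₁ (p , _))))) = there (there (here p))
    tail∈C _ (there (there (here (inj₂ (p , _))))) = there (there (there (here p)))
    tail∈C _ (there (there (there (here (inj₁ (p , _)))))) = there (there (there (here p)))
    tail∈C _ (there (there (there (here (inj₂ (p , _)))))) = here p
  cycleOn : ∀ {C} → (∀ e → e ∈E C → e ∈U S) → CycleOn (VertexOf S) C
  cycleOn C⊆S =
    tail∈ (C⊆S _ (here (sameEdge-refl _))) ∷
    tail∈ (C⊆S _ (there (here (sameEdge-refl _)))) ∷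
    tail∈ (C⊆S _ (there (there (here (sameEdge-refl _))))) ∷
    tail∈ (C⊆S _ (there (there (there (here (sameEdge-refl _)))))) ∷ []

record BijectionOn (P Q : Vertex → Set) : Set where
  field
    to from : Vertex → Vertex
    to-∈ : ∀ {x} → P x → Q (to x)
    from-∈ : ∀ {y} → Q y → P (from y)
    from-to : ∀ {x} → P x → from (to x) ≡ x
    to-from : ∀ {y} → Q y → to (from y) ≡ y

  to-injective : InjectiveWithin to P
  to-injective x y px py eq = trans (sym (from-to px)) (trans (cong from eq) (from-to py))

  mapFamily-from-to : ∀ {T} → FamilyOn P T → mapFamily from (mapFamily to T) ≡ T
  mapFamily-from-to {T} pT =
    trans (mapFamily-∘ to from T) (mapFamily-id (from ∘ to) (FamilyOn-weaken from-to pT))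

  sameFamily-transpose : ∀ {T S} → FamilyOn P T → SameFamily (mapFamily to T) S →
                         SameFamily T (mapFamily from S)
  sameFamily-transpose {T} {S} pT toT≈S =
    subst (λ X → SameFamily X (mapFamily from S)) (mapFamily-from-to pT) (sameFamily-map from toT≈S)

open BijectionOn

inverse : ∀ {P Q} → BijectionOn P Q → BijectionOn Q P
inverse φ = record
  { to = from φ ; from = to φ
  ; to-∈ = from-∈ φ ; from-∈ = to-∈ φ
  ; from-to = to-from φ ; to-from = from-to φ
  }

_∘ᵇ_ : ∀ {P Q R} → BijectionOn Q R → BijectionOn P Q → BijectionOn P R
ψ ∘ᵇ φ = record
  { to = to ψ ∘ to φ
  ; from = from φ ∘ from ψ
  ; to-∈ = to-∈ ψ ∘ to-∈ φ
  ; from-∈ = from-∈ φ ∘ from-∈ ψ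
  ; from-to = λ px → trans (cong (from φ) (from-to ψ (to-∈ φ px))) (from-to φ px)
  ; to-from = λ rz → trans (cong (to ψ) (to-from φ (from-∈ ψ rz))) (to-from ψ rz)
  }

nth : List ℕ → ℕ → ℕ
nth [] _ = 0
nth (v ∷ vs) zero = v
nth (v ∷ vs) (suc i) = nth vs i

indexOf : List ℕ → ℕ → ℕ
indexOf [] x = 0
indexOf (v ∷ vs) x with x ≟ v
... | yes _ = 0
... | no _ = suc (indexOf vs x)

nth-indexOf : ∀ {x} vs → x ∈ vs → nth vs (indexOf vs x) ≡ x
nth-indexOf {x} (v ∷ vs) x∈ with x ≟ v | x∈
... | yes x≡v | _ = sym x≡v
... | no x≢v | here x≡v = ⊥-elim (x≢v x≡v)
... | no _ | there x∈vs = nth-indexOf vs x∈vs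

indexOf<length : ∀ {x} vs → x ∈ vs → indexOf vs x < length vs
indexOf<length {x} (v ∷ vs) x∈ with x ≟ v | x∈
... | yes _ | _ = s≤s z≤n
... | no x≢v | here x≡v = ⊥-elim (x≢v x≡v)
... | no _ | there x∈vs = s≤s (indexOf<length vs x∈vs)

nth-∈ : ∀ {i} vs → i < length vs → nth vs i ∈ vs
nth-∈ {zero} (v ∷ vs) _ = here refl
nth-∈ {suc i} (v ∷ vs) (s≤s i<) = there (nth-∈ vs i<)

indexOf-nth : ∀ {i} vs → Unique vs → i < length vs → indexOf vs (nth vs i) ≡ i
indexOf-nth {zero} (v ∷ vs) _ _ with v ≟ v
... | yes _ = refl
... | no v≢v = ⊥-elim (v≢v refl)
indexOf-nth {suc i} (v ∷ vs) (v∉vs ∷ unique) (s≤s i<) with nth vs i ≟ v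
... | yes vᵢ≡v = ⊥-elim (All.lookup v∉vs (nth-∈ vs i<) (sym vᵢ≡v))
... | no _ = cong suc (indexOf-nth vs unique i<)

indexing : ∀ {n} xs → length (deduplicate _≟_ xs) ≡ n → BijectionOn (_∈ xs) (_< n)
indexing {n} xs len≡n = record
  { to = indexOf distinct
  ; from = nth distinct
  ; to-∈ = λ x∈ → subst (_ <_) len≡n (indexOf<length distinct (∈-deduplicate⁺ _≟_ x∈))
  ; from-∈ = λ i< → ∈-deduplicate⁻ _≟_ xs (nth-∈ distinct (i<length i<))
  ; from-to = λ x∈ → nth-indexOf distinct (∈-deduplicate⁺ _≟_ x∈)
  ; to-from = λ i< → indexOf-nth distinct (deduplicate-! xs) (i<length i<)
  }
  where
  distinct : List ℕ
  distinct = deduplicate _≟_ xs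
  i<length : ∀ {i} → i < n → i < length distinct
  i<length = subst (_ <_) (sym len≡n)

-- A permutation of {0, …, n-1} is stored as the list of its values.
invertList : ℕ → List ℕ → List ℕ
invertList n p = map (indexOf p) (upTo n)

IsPermutation : ℕ → List ℕ → Set
IsPermutation n p =
  All (λ x → nth p x < n × nth (invertList n p) (nth p x) ≡ x) (upTo n) ×
  All (λ y → nth (invertList n p) y < n × nth p (nth (invertList n p) y) ≡ y) (upTo n)

isPermutation? : ∀ n p → Dec (IsPermutation n p)
isPermutation? n p =
  All.all? (λ x → (nth p x <? n) ×-dec (nth (invertList n p) (nth p x) ≟ x)) (upTo n) ×-dec
  All.all? (λ y → (nth (invertList n p) y <? n) ×-dec (nth p (nth (invertList n p) y) ≟ y)) (upTo n)

permutation : ∀ {n} p → IsPermutation n p → BijectionOn (_< n) (_< n)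
permutation {n} p (forth , back) = record
  { to = nth p
  ; from = nth (invertList n p)
  ; to-∈ = λ x< → proj₁ (All.lookup forth (∈-upTo⁺ x<))
  ; from-∈ = λ y< → proj₁ (All.lookup back (∈-upTo⁺ y<))
  ; from-to = λ x< → proj₂ (All.lookup forth (∈-upTo⁺ x<))
  ; to-from = λ y< → proj₂ (All.lookup back (∈-upTo⁺ y<))
  }

-- Canonical descriptions of cycles

rotate : Cycle4 → Cycle4
rotate (cyc a b c d) = cyc b c d a

reflect : Cycle4 → Cycle4
reflect (cyc a b c d) = cyc a d c b

sameCycle-rotate : ∀ C → SameCycle C (rotate C)
sameCycle-rotate (cyc a b c d) = forth , back
  where
  forth : cyc a b c d ⊆E cyc b c d a
  forth _ (here p) = there (there (there (here p)))
  forth _ (there (here p)) = here p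
  forth _ (there (there (here p))) = there (here p)
  forth _ (there (there (there (here p)))) = there (there (here p))
  back : cyc b c d a ⊆E cyc a b c d
  back _ (here p) = there (here p)
  back _ (there (here p)) = there (there (here p))
  back _ (there (there (here p))) = there (there (there (here p)))
  back _ (there (there (there (here p)))) = here p

sameCycle-reflect : ∀ C → SameCycle C (reflect C)
sameCycle-reflect (cyc a b c d) = flip a b c d , flip a d c b
  where
  flip : ∀ a b c d → cyc a b c d ⊆E cyc a d c b
  flip a b c d _ (here p) = there (there (there (here (sameEdge-swap a b p))))
  flip a b c d _ (there (here p)) = there (there (here (sameEdge-swap b c p)))
  flip a b c d _ (there (there (here p))) = there (here (sameEdge-swap c d p))
  flip a b c d _ (there (there (there (here p)))) = here (sameEdge-swap d a p)

-- Opaque so that canonical C is only unfolded where a computation needs it.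
opaque
  variants : Cycle4 → List Cycle4
  variants C = rotate C ∷ rotate (rotate C) ∷ rotate (rotate (rotate C)) ∷
    reflect C ∷ rotate (reflect C) ∷ rotate (rotate (reflect C)) ∷
    rotate (rotate (rotate (reflect C))) ∷ []

  variants-sameCycle : ∀ C → All (SameCycle C) (variants C)
  variants-sameCycle C = r₁ ∷ r₂ ∷ r₃ ∷ s₀ ∷ s₁ ∷ s₂ ∷ s₃ ∷ []
    where
    r₁ : SameCycle C (rotate C)
    r₁ = sameCycle-rotate C
    r₂ : SameCycle C (rotate (rotate C))
    r₂ = sameCycle-trans r₁ (sameCycle-rotate _)
    r₃ : SameCycle C (rotate (rotate (rotate C)))
    r₃ = sameCycle-trans r₂ (sameCycle-rotate _)
    s₀ : SameCycle C (reflect C)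
    s₀ = sameCycle-reflect C
    s₁ : SameCycle C (rotate (reflect C))
    s₁ = sameCycle-trans s₀ (sameCycle-rotate _)
    s₂ : SameCycle C (rotate (rotate (reflect C)))
    s₂ = sameCycle-trans s₁ (sameCycle-rotate _)
    s₃ : SameCycle C (rotate (rotate (rotate (reflect C))))
    s₃ = sameCycle-trans s₂ (sameCycle-rotate _)

-- On vertices below 6 the key is injective, so the lightest variant is a
-- canonical description of the edge set.
key : Cycle4 → ℕ
key (cyc a b c d) = a * 216 + b * 36 + c * 6 + d

lighter : Cycle4 → Cycle4 → Cycle4
lighter C D = if key D <ᵇ key C then D else C

lightest : Cycle4 → List Cycle4 → Cycle4
lightest C [] = C
lightest C (D ∷ Ds) = lightest (lighter C D) Ds

lightest-∈ : ∀ C Ds → lightest C Ds ∈ C ∷ Ds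
lightest-∈ C [] = here refl
lightest-∈ C (D ∷ Ds) with key D <ᵇ key C | lightest-∈ (lighter C D) Ds
... | true | here eq = there (here eq)
... | false | here eq = here eq
... | _ | there ∈Ds = there (there ∈Ds)

canonical : Cycle4 → Cycle4
canonical C = lightest C (variants C)

sameCycle-canonical : ∀ C → SameCycle C (canonical C)
sameCycle-canonical C = All.lookup (sameCycle-refl C ∷ variants-sameCycle C) (lightest-∈ C (variants C))

canonicalFamily : Family → Family
canonicalFamily T = map canonical T

sameFamily-canonical : ∀ T → SameFamily T (canonicalFamily T)
sameFamily-canonical T = forth , back
  where
  forth : T ⊆C canonicalFamily T
  forth C C∈T with D , D∈T , C≈D ← find C∈T
    = Any.map⁺ (lose D∈T (sameCycle-trans C≈D (sameCycle-canonical D)))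
  back : canonicalFamily T ⊆C T
  back C C∈cT =
    Any.map (λ {D} C≈cD → sameCycle-trans C≈cD (sameCycle-sym (sameCycle-canonical D))) (Any.map⁻ C∈cT)

notIn-canonical : ∀ {S} T → All (λ C → ¬ C ∈C S) T → All (λ C → ¬ C ∈C S) (canonicalFamily T)
notIn-canonical {S} T T∉S =
  All.map⁺ (All.map (λ {C} C∉S cC∈S → C∉S (∈C-resp S (sameCycle-canonical C) cC∈S)) T∉S)

CanonicallyEqual : Family → Family → Set
CanonicallyEqual T S = All (_∈ S) (canonicalFamily T) × All (_∈ canonicalFamily T) S

canonicallyEqual⇒sameFamily : ∀ {T S} → CanonicallyEqual T S → SameFamily T S
canonicallyEqual⇒sameFamily {T} (cT⊆S , S⊆cT) =
  sameFamily-trans (sameFamily-canonical T) (⊆⇒⊆C cT⊆S , ⊆⇒⊆C S⊆cT)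
  where
  ⊆⇒⊆C : ∀ {X Y} → All (_∈ Y) X → X ⊆C Y
  ⊆⇒⊆C X⊆Y C C∈X with D , D∈X , C≈D ← find C∈X = lose (All.lookup X⊆Y D∈X) C≈D

cycle≟ : (C D : Cycle4) → Dec (C ≡ D)
cycle≟ (cyc a b c d) (cyc a′ b′ c′ d′) =
  map′ (λ { (refl , refl , refl , refl) → refl }) (λ { refl → refl , refl , refl , refl })
    ((a ≟ a′) ×-dec (b ≟ b′) ×-dec (c ≟ c′) ×-dec (d ≟ d′))

canonicallyEqual? : ∀ T S → Dec (CanonicallyEqual T S)
canonicallyEqual? T S =
  All.all? (λ C → Any.any? (cycle≟ C) S) (canonicalFamily T) ×-dec
  All.all? (λ C → Any.any? (cycle≟ C) (canonicalFamily T)) S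

-- Packings of 4-cycles on six vertices

_∈ᴱ_ : Edge → List Edge → Set
e ∈ᴱ E = Any (SameEdge e) E

_∈ᴱ?_ : (e : Edge) (E : List Edge) → Dec (e ∈ᴱ E)
e ∈ᴱ? E = Any.any? (sameEdge? e) E

EdgesWithin : Family → List Edge → Set
EdgesWithin T E = ∀ e → e ∈U T → e ∈ᴱ E

edgesOfFamily : Family → List Edge
edgesOfFamily T = concatMap edgesOf T

edgesWithin-edgesOfFamily : ∀ T → EdgesWithin T (edgesOfFamily T)
edgesWithin-edgesOfFamily T _ = Any.concatMap⁺ edgesOf

removeEdgesOf : Cycle4 → List Edge → List Edge
removeEdgesOf C E = filter (λ e → ¬? (e ∈E? C)) E

removeEdgesOf-keeps : ∀ {e} C E → e ∈ᴱ E → ¬ e ∈E C → e ∈ᴱ removeEdgesOf C E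
removeEdgesOf-keeps C E e∈E e∉C with e′ , e′∈E , e≈e′ ← find e∈E
  = lose (∈-filter⁺ (λ e → ¬? (e ∈E? C)) e′∈E (λ e′∈C → e∉C (∈E-resp C e≈e′ e′∈C))) e≈e′

removeEdgesOf-shrinks : ∀ {e} C E → e ∈ᴱ E → e ∈E C → length (removeEdgesOf C E) < length E
removeEdgesOf-shrinks C E e∈E e∈C with e′ , e′∈E , e≈e′ ← find e∈E
  = filter-notAll (λ e → ¬? (e ∈E? C)) E
      (lose e′∈E (λ e′∉C → e′∉C (∈E-resp C (sameEdge-sym e≈e′) e∈C)))

-- The 45 four-cycles of K₆, each given by its canonical description.
canonicalCycles : List Cycle4
canonicalCycles = cyc 0 1 2 3 ∷ cyc 0 1 2 4 ∷ cyc 0 1 2 5 ∷ cyc 0 1 3 2 ∷ cyc 0 1 3 4 ∷ cyc 0 1 3 5 ∷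
  cyc 0 1 4 2 ∷ cyc 0 1 4 3 ∷ cyc 0 1 4 5 ∷ cyc 0 1 5 2 ∷ cyc 0 1 5 3 ∷ cyc 0 1 5 4 ∷
  cyc 0 2 1 3 ∷ cyc 0 2 1 4 ∷ cyc 0 2 1 5 ∷ cyc 0 2 3 4 ∷ cyc 0 2 3 5 ∷ cyc 0 2 4 3 ∷
  cyc 0 2 4 5 ∷ cyc 0 2 5 3 ∷ cyc 0 2 5 4 ∷ cyc 0 3 1 4 ∷ cyc 0 3 1 5 ∷ cyc 0 3 2 4 ∷
  cyc 0 3 2 5 ∷ cyc 0 3 4 5 ∷ cyc 0 3 5 4 ∷ cyc 0 4 1 5 ∷ cyc 0 4 2 5 ∷ cyc 0 4 3 5 ∷
  cyc 1 2 3 4 ∷ cyc 1 2 3 5 ∷ cyc 1 2 4 3 ∷ cyc 1 2 4 5 ∷ cyc 1 2 5 3 ∷ cyc 1 2 5 4 ∷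
  cyc 1 3 2 4 ∷ cyc 1 3 2 5 ∷ cyc 1 3 4 5 ∷ cyc 1 3 5 4 ∷ cyc 1 4 2 5 ∷ cyc 1 4 3 5 ∷
  cyc 2 3 4 5 ∷ cyc 2 3 5 4 ∷ cyc 2 4 3 5 ∷ []

opaque
  unfolding variants

  canonical-∈-canonicalCycles : ∀ {C} → CycleOn (_< 6) C → IsCycle4 C → canonical C ∈ canonicalCycles
  canonical-∈-canonicalCycles {cyc a b c d} (a< ∷ b< ∷ c< ∷ d< ∷ []) =
    All.lookup (All.lookup (All.lookup (All.lookup table
      (∈-upTo⁺ a<)) (∈-upTo⁺ b<)) (∈-upTo⁺ c<)) (∈-upTo⁺ d<)
    where
    table : All (λ a → All (λ b → All (λ c → All (λ d →
              IsCycle4 (cyc a b c d) → canonical (cyc a b c d) ∈ canonicalCycles)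
            (upTo 6)) (upTo 6)) (upTo 6)) (upTo 6)
    table = from-yes (All.all? (λ a → All.all? (λ b → All.all? (λ c → All.all? (λ d →
              isCycle4? (cyc a b c d) →-dec Any.any? (cycle≟ (canonical (cyc a b c d))) canonicalCycles)
            (upTo 6)) (upTo 6)) (upTo 6)) (upTo 6))

mutual
  packings : ℕ → List Edge → List Family
  packings zero E = [] ∷ []
  packings (suc n) E = [] ∷ concatMap (extend n E) canonicalCycles

  extend : ℕ → List Edge → Cycle4 → List Family
  extend n E C = extendIf n E C (does (All.all? (_∈ᴱ? E) (edgesOf C)))

  extendIf : ℕ → List Edge → Cycle4 → Bool → List Family
  extendIf n E C true = map (C ∷_) (packings n (removeEdgesOf C E))
  extendIf n E C false = []

[]-∈-packings : ∀ n E → [] ∈ packings n E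
[]-∈-packings zero _ = here refl
[]-∈-packings (suc _) _ = here refl

∷-∈-packings : ∀ {n E C X} → C ∈ canonicalCycles → All (_∈ᴱ E) (edgesOf C) →
               X ∈ packings n (removeEdgesOf C E) → (C ∷ X) ∈ packings (suc n) E
∷-∈-packings {n} {E} {C} {X} C∈ C⊆E X∈ =
  there (∈-concatMap⁺ (extend n E) (lose C∈ (∈-extendIf (All.all? (_∈ᴱ? E) (edgesOf C)))))
  where
  ∈-extendIf : (C⊆E? : Dec (All (_∈ᴱ E) (edgesOf C))) → (C ∷ X) ∈ extendIf n E C (does C⊆E?)
  ∈-extendIf (yes _) = ∈-map⁺ (C ∷_) X∈
  ∈-extendIf (no C⊈E) = ⊥-elim (C⊈E C⊆E)

-- Every cycle uses up at least one edge of E, so length E bounds the recursion depth needed.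
canonicalFamily-∈-packings : ∀ n E T → length E ≤ n → FamilyOn (_< 6) T → EdgeDisjointFamily T →
                             EdgesWithin T E → canonicalFamily T ∈ packings n E
canonicalFamily-∈-packings n E [] _ _ _ _ = []-∈-packings n E
canonicalFamily-∈-packings zero [] (C ∷ T) _ _ _ within
  with () ← within _ (here (here (sameEdge-refl _)))
canonicalFamily-∈-packings (suc n) E (C ∷ T) len≤ (pC ∷ pT) (isC ∷ isT , disjC ∷ disjT) within =
  ∷-∈-packings (canonical-∈-canonicalCycles pC isC) cC⊆E
    (canonicalFamily-∈-packings n E′ T (s≤s⁻¹ (<-≤-trans shrinks len≤)) pT (isT , disjT) within′)
  where
  C≈cC : SameCycle C (canonical C)
  C≈cC = sameCycle-canonical C
  E′ : List Edge
  E′ = removeEdgesOf (canonical C) E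
  ab∈C : (a C , b C) ∈E C
  ab∈C = here (sameEdge-refl _)
  cC⊆E : All (_∈ᴱ E) (edgesOf (canonical C))
  cC⊆E = tabulate≈ sameEdge-refl λ e∈cC → within _ (here (proj₂ C≈cC _ e∈cC))
  shrinks : length E′ < length E
  shrinks = removeEdgesOf-shrinks (canonical C) E (within _ (here ab∈C)) (proj₁ C≈cC _ ab∈C)
  within′ : EdgesWithin T E′
  within′ e e∈T with D , D∈T , e∈D ← find e∈T
    = removeEdgesOf-keeps (canonical C) E (within e (there e∈T))
        (λ e∈cC → All.lookup disjC D∈T e (proj₂ C≈cC e e∈cC) e∈D)

packingsOf : Family → List Family
packingsOf M = packings (length (edgesOfFamily M)) (edgesOfFamily M)

K₆ : List Edge
K₆ = (0 , 1) ∷ (0 , 2) ∷ (0 , 3) ∷ (0 , 4) ∷ (0 , 5) ∷ (1 , 2) ∷ (1 , 3) ∷ (1 , 4) ∷ (1 , 5) ∷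
     (2 , 3) ∷ (2 , 4) ∷ (2 , 5) ∷ (3 , 4) ∷ (3 , 5) ∷ (4 , 5) ∷ []

edgesWithin-K₆ : ∀ {T} → FamilyOn (_< 6) T → All IsCycle4 T → EdgesWithin T K₆
edgesWithin-K₆ pT cycles e e∈T with C , C∈T , e∈C ← find e∈T
  = lookup≈ (λ e≈e′ → Any.map (sameEdge-trans e≈e′))
      (edgesIn (All.lookup pT C∈T) (All.lookup cycles C∈T)) e∈C
  where
  table : All (λ u → All (λ v → ¬ u ≡ v → (u , v) ∈ᴱ K₆) (upTo 6)) (upTo 6)
  table = from-yes (All.all? (λ u → All.all? (λ v → ¬? (u ≟ v) →-dec (u , v) ∈ᴱ? K₆) (upTo 6)) (upTo 6))
  edge : ∀ {u v} → u < 6 → v < 6 → ¬ u ≡ v → (u , v) ∈ᴱ K₆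
  edge u< v< = All.lookup (All.lookup table (∈-upTo⁺ u<)) (∈-upTo⁺ v<)
  edgesIn : ∀ {C} → CycleOn (_< 6) C → IsCycle4 C → All (_∈ᴱ K₆) (edgesOf C)
  edgesIn (a< ∷ b< ∷ c< ∷ d< ∷ []) (a≢b , _ , a≢d , b≢c , _ , c≢d) =
    edge a< b< a≢b ∷ edge b< c< b≢c ∷ edge c< d< c≢d ∷ edge d< a< (a≢d ∘ sym) ∷ []

-- K₆ minus the matching {01, 23, 45} is the octahedron.  Its three equators form one
-- decomposition into 4-cycles; modelT₁ is the other one up to relabelling, and
-- modelT₂, modelT₃, modelT₃′ are further decompositions of the same edge set.
modelT₁ modelT₂ modelT₃ modelT₃′ equators : Family
modelT₁ = cyc 0 2 1 4 ∷ cyc 0 3 1 5 ∷ cyc 2 4 3 5 ∷ []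
modelT₂ = cyc 0 4 1 5 ∷ cyc 0 2 4 3 ∷ cyc 1 2 5 3 ∷ []
modelT₃ = cyc 0 4 2 5 ∷ cyc 1 4 3 5 ∷ cyc 0 2 1 3 ∷ []
modelT₃′ = cyc 1 4 2 5 ∷ cyc 0 4 3 5 ∷ cyc 0 2 1 3 ∷ []
equators = cyc 0 2 1 3 ∷ cyc 0 4 1 5 ∷ cyc 2 4 3 5 ∷ []

otherVertices : Cycle4 → List ℕ
otherVertices C = filter (λ v → ¬? (Any.any? (v ≟_) (verticesOf C))) (upTo 6)

sending : List ℕ → List ℕ → List ℕ
sending sources targets = map (image sources targets) (upTo 6)
  where
  image : List ℕ → List ℕ → ℕ → ℕ
  image (s ∷ ss) (t ∷ ts) v = if v ≡ᵇ s then t else image ss ts v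
  image _ _ v = 0

-- Candidates for a relabelling of L onto A: the first cycle of L goes, vertex by
-- vertex, onto one of the eight descriptions of a cycle of A, and its two other
-- vertices onto the two remaining ones in either order.
candidateRelabellings : Family → Family → List (List ℕ)
candidateRelabellings A [] = []
candidateRelabellings A (K ∷ _) = map (sending (verticesOf K ++ otherVertices K)) (concatMap targets A)
  where
  targets : Cycle4 → List (List ℕ)
  targets C = concatMap
    (λ V → (verticesOf V ++ otherVertices V) ∷ (verticesOf V ++ reverse (otherVertices V)) ∷ [])
    (C ∷ variants C)

modelSymmetries : List (List ℕ)
modelSymmetries =
  (0 ∷ 1 ∷ 2 ∷ 3 ∷ 4 ∷ 5 ∷ []) ∷ (0 ∷ 1 ∷ 3 ∷ 2 ∷ 5 ∷ 4 ∷ []) ∷ (0 ∷ 1 ∷ 4 ∷ 5 ∷ 2 ∷ 3 ∷ []) ∷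
  (0 ∷ 1 ∷ 5 ∷ 4 ∷ 3 ∷ 2 ∷ []) ∷ (1 ∷ 0 ∷ 2 ∷ 3 ∷ 4 ∷ 5 ∷ []) ∷ (1 ∷ 0 ∷ 3 ∷ 2 ∷ 5 ∷ 4 ∷ []) ∷
  (1 ∷ 0 ∷ 4 ∷ 5 ∷ 2 ∷ 3 ∷ []) ∷ (1 ∷ 0 ∷ 5 ∷ 4 ∷ 3 ∷ 2 ∷ []) ∷ []

RelabelledBy : List ℕ → Family → Family → Set
RelabelledBy p L A = CanonicallyEqual (mapFamily (nth p) L) A × IsPermutation 6 p

relabelledBy? : ∀ p L A → Dec (RelabelledBy p L A)
relabelledBy? p L A = canonicallyEqual? (mapFamily (nth p) L) A ×-dec isPermutation? 6 p

RelabelsOnto : Family → Family → Set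
RelabelsOnto L A = Any (λ p → RelabelledBy p L A) (candidateRelabellings A L)

PartnerCandidate : Family → Family → Set
PartnerCandidate M L = M ⊆U L × All (λ C → ¬ C ∈C M) L

partnerCandidate? : ∀ M L → Dec (PartnerCandidate M L)
partnerCandidate? M L = (M ⊆U? L) ×-dec All.all? (λ C → ¬? (C ∈C? M)) L

familyOn<6? : ∀ T → Dec (FamilyOn (_< 6) T)
familyOn<6? = All.all? (λ C → All.all? (_<? 6) (verticesOf C))

opaque
  unfolding variants

  triples-classified :
    All (λ L → length L ≡ 3 → RelabelsOnto L modelT₁ ⊎ RelabelsOnto L equators) (packings 15 K₆)
  triples-classified = from-yes (All.all? (λ L → (length L ≟ 3) →-dec
    (Any.any? (λ p → relabelledBy? p L modelT₁) (candidateRelabellings modelT₁ L) ⊎-dec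
     Any.any? (λ p → relabelledBy? p L equators) (candidateRelabellings equators L))) (packings 15 K₆))

  equators-partnerless : All (λ L → ¬ PartnerCandidate equators L) (packingsOf equators)
  equators-partnerless =
    from-yes (All.all? (λ L → ¬? (partnerCandidate? equators L)) (packingsOf equators))

  modelT₁-partners :
    All (λ L → PartnerCandidate modelT₁ L →
           Any (λ p → CanonicallyEqual (mapFamily (nth p) modelT₁) modelT₁ × RelabelledBy p L modelT₂)
               modelSymmetries)
        (packingsOf modelT₁)
  modelT₁-partners = from-yes (All.all? (λ L → partnerCandidate? modelT₁ L →-dec
    Any.any? (λ p → canonicallyEqual? (mapFamily (nth p) modelT₁) modelT₁ ×-dec relabelledBy? p L modelT₂)
             modelSymmetries)
    (packingsOf modelT₁))

  modelT₁-thirdTrades :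
    All (λ L → PartnerCandidate modelT₁ L → All (λ C → ¬ C ∈C modelT₂) L →
           CanonicallyEqual L modelT₃ ⊎ CanonicallyEqual L modelT₃′)
        (packingsOf modelT₁)
  modelT₁-thirdTrades = from-yes (All.all? (λ L → partnerCandidate? modelT₁ L →-dec
    All.all? (λ C → ¬? (C ∈C? modelT₂)) L →-dec
    (canonicallyEqual? L modelT₃ ⊎-dec canonicallyEqual? L modelT₃′))
    (packingsOf modelT₁))

modelT₁-on : FamilyOn (_< 6) modelT₁
modelT₁-on = from-yes (familyOn<6? modelT₁)

modelT₂-on : FamilyOn (_< 6) modelT₂
modelT₂-on = from-yes (familyOn<6? modelT₂)

modelT₃-on : FamilyOn (_< 6) modelT₃
modelT₃-on = from-yes (familyOn<6? modelT₃)

modelT₃′-on : FamilyOn (_< 6) modelT₃′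
modelT₃′-on = from-yes (familyOn<6? modelT₃′)

modelBitrade₁₂ : Bitrade modelT₁ modelT₂
modelBitrade₁₂ = from-yes (bitrade? modelT₁ modelT₂)

modelBitrade₁₃ : Bitrade modelT₁ modelT₃
modelBitrade₁₃ = from-yes (bitrade? modelT₁ modelT₃)

modelBitrade₂₃ : Bitrade modelT₂ modelT₃
modelBitrade₂₃ = from-yes (bitrade? modelT₂ modelT₃)

modelBitrade₁₃′ : Bitrade modelT₁ modelT₃′
modelBitrade₁₃′ = from-yes (bitrade? modelT₁ modelT₃′)

modelBitrade₂₃′ : Bitrade modelT₂ modelT₃′
modelBitrade₂₃′ = from-yes (bitrade? modelT₂ modelT₃′)

modelT₃≉modelT₃′ : ¬ SameFamily modelT₃ modelT₃′
modelT₃≉modelT₃′ = from-no (sameFamily? modelT₃ modelT₃′)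

-- Reduction of a bitrade to the model

sameFamily-relabel : ∀ {T X A} f p → SameFamily (mapFamily f T) X →
                     CanonicallyEqual (mapFamily (nth p) X) A → SameFamily (mapFamily (nth p ∘ f) T) A
sameFamily-relabel f p fT≈X pX≡A = sameFamily-∘ f (nth p) fT≈X (canonicallyEqual⇒sameFamily pX≡A)

module _ {P} (σ : BijectionOn P (_< 6)) where

  image : Family → Family
  image T = canonicalFamily (mapFamily (to σ) T)

  image-∈-packings : ∀ {n E T} → length E ≤ n → FamilyOn P T → EdgeDisjointFamily T →
                     EdgesWithin (mapFamily (to σ) T) E → image T ∈ packings n E
  image-∈-packings len≤ pT edfT = canonicalFamily-∈-packings _ _ _ len≤
    (FamilyOn-map (to σ) (to-∈ σ) pT) (edgeDisjointFamily-map (to σ) (to-injective σ) pT edfT)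

  relabel : ∀ {T A} → RelabelsOnto (image T) A →
            Σ (BijectionOn P (_< 6)) λ τ → SameFamily (mapFamily (to τ) T) A
  relabel onto =
    let p , _ , p-sends , p-perm = find onto
    in permutation p p-perm ∘ᵇ σ , sameFamily-relabel (to σ) p (sameFamily-canonical _) p-sends

  image-avoids : ∀ {T S M} → FamilyOn P T → FamilyOn P S → All (λ C → ¬ C ∈C S) T →
                 SameFamily (mapFamily (to σ) S) M → All (λ C → ¬ C ∈C M) (image T)
  image-avoids pT pS T∉S σS≈M = notIn-canonical _
    (All.map (λ C∉σS C∈M → C∉σS (proj₂ σS≈M _ C∈M)) (notIn-map (to σ) (to-injective σ) pT pS T∉S))

  image-partner : ∀ {T S M} → FamilyOn P T → FamilyOn P S → Bitrade T S →
                  SameFamily (mapFamily (to σ) T) M → image S ∈ packingsOf M × PartnerCandidate M (image S)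
  image-partner {T} {S} {M} pT pS bitrade@(_ , edfS , _ , same) σT≈M = S∈ , covers , avoids
    where
    S∈ : image S ∈ packingsOf M
    S∈ = image-∈-packings ≤-refl pS edfS
      (λ e → edgesWithin-edgesOfFamily M e ∘ sameFamily⇒⊆U σT≈M e ∘ ⊆U-map (to σ) (proj₂ ∘ same) e)
    covers : M ⊆U image S
    covers e = sameFamily⇒⊆U (sameFamily-canonical _) e ∘ ⊆U-map (to σ) (proj₁ ∘ same) e ∘
               sameFamily⇒⊆U (sameFamily-sym σT≈M) e
    avoids : All (λ C → ¬ C ∈C M) (image S)
    avoids = image-avoids pS pT (bitrade-notIn⁻ bitrade) σT≈M

record ModelIsomorphism (T₁ T₂ : Family) : Set where
  field
    σ : BijectionOn (VertexOf T₁) (_< 6)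
    σT₁≈modelT₁ : SameFamily (mapFamily (to σ) T₁) modelT₁
    σT₂≈modelT₂ : SameFamily (mapFamily (to σ) T₂) modelT₂

module _ {T₁ T₂} (bitrade : Bitrade T₁ T₂) where

  T₁-on : FamilyOn (VertexOf T₁) T₁
  T₁-on = ⊆U⇒FamilyOn (λ _ e∈T₁ → e∈T₁)

  T₂-on : FamilyOn (VertexOf T₁) T₂
  T₂-on = ⊆U⇒FamilyOn (bitrade-⊇U bitrade)

  not-onto-equators : (σ : BijectionOn (VertexOf T₁) (_< 6)) →
                      ¬ SameFamily (mapFamily (to σ) T₁) equators
  not-onto-equators σ σT₁≈equators =
    let L∈ , candidate = image-partner σ T₁-on T₂-on bitrade σT₁≈equators
    in All.lookup equators-partnerless L∈ candidate

  onto-modelT₁ : (σ : BijectionOn (VertexOf T₁) (_< 6)) → SameFamily (mapFamily (to σ) T₁) modelT₁ →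
                 ModelIsomorphism T₁ T₂
  onto-modelT₁ σ σT₁≈modelT₁ =
    let L∈ , candidate = image-partner σ T₁-on T₂-on bitrade σT₁≈modelT₁
        p , _ , p-fixes , p-sends , p-perm = find (All.lookup modelT₁-partners L∈ candidate)
    in record
      { σ = permutation p p-perm ∘ᵇ σ
      ; σT₁≈modelT₁ = sameFamily-relabel (to σ) p σT₁≈modelT₁ p-fixes
      ; σT₂≈modelT₂ = sameFamily-relabel (to σ) p (sameFamily-canonical _) p-sends
      }

modelIsomorphism : ∀ {T₁ T₂} → Bitrade36 T₁ T₂ → ModelIsomorphism T₁ T₂
modelIsomorphism {T₁} {T₂} (bitrade@(edf₁ , _) , volume≡3 , foundation≡6) =
  classify (All.lookup triples-classified L∈ length≡3)
  where
  σ₀ : BijectionOn (VertexOf T₁) (_< 6)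
  σ₀ = indexing (verticesOfFamily T₁) foundation≡6
  L∈ : image σ₀ T₁ ∈ packings 15 K₆
  L∈ = image-∈-packings σ₀ ≤-refl (T₁-on bitrade) edf₁
    (edgesWithin-K₆ (FamilyOn-map (to σ₀) (to-∈ σ₀) (T₁-on bitrade))
                    (proj₁ (edgeDisjointFamily-map (to σ₀) (to-injective σ₀) (T₁-on bitrade) edf₁)))
  length≡3 : length (image σ₀ T₁) ≡ 3
  length≡3 = trans (length-map canonical (mapFamily (to σ₀) T₁))
                   (trans (length-map (mapCycle (to σ₀)) T₁) volume≡3)
  classify : RelabelsOnto (image σ₀ T₁) modelT₁ ⊎ RelabelsOnto (image σ₀ T₁) equators →
             ModelIsomorphism T₁ T₂
  classify (inj₁ onto) = uncurry (onto-modelT₁ bitrade) (relabel σ₀ onto)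
  classify (inj₂ onto) = ⊥-elim (uncurry (not-onto-equators bitrade) (relabel σ₀ onto))

isomorphic-via-model : ∀ {T₁ T₂ S₁ S₂} → Bitrade S₁ S₂ → ModelIsomorphism T₁ T₂ → ModelIsomorphism S₁ S₂ →
                       Isomorphic T₁ T₂ S₁ S₂
isomorphic-via-model {T₁} {S₁ = S₁} bitradeS φ ψ =
  to χ , to-injective χ ,
  sameFamily-∘ (to φ.σ) (from ψ.σ) φ.σT₁≈modelT₁
    (sameFamily-sym (sameFamily-transpose ψ.σ (T₁-on bitradeS) ψ.σT₁≈modelT₁)) ,
  sameFamily-∘ (to φ.σ) (from ψ.σ) φ.σT₂≈modelT₂
    (sameFamily-sym (sameFamily-transpose ψ.σ (T₂-on bitradeS) ψ.σT₂≈modelT₂))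
  where
  module φ = ModelIsomorphism φ
  module ψ = ModelIsomorphism ψ
  χ : BijectionOn (VertexOf T₁) (VertexOf S₁)
  χ = inverse ψ.σ ∘ᵇ φ.σ

bitrade-pullback : ∀ {P Q T M N} (σ : BijectionOn P Q) → FamilyOn P T → EdgeDisjointFamily T →
                   SameFamily (mapFamily (to σ) T) M → FamilyOn Q M → FamilyOn Q N → Bitrade M N →
                   Bitrade T (mapFamily (from σ) N)
bitrade-pullback σ pT edfT σT≈M pM pN bitrade = bitrade-congˡ edfT (sameFamily-transpose σ pT σT≈M)
  (bitrade-map (from σ) (to-injective (inverse σ)) pM pN bitrade)

threeWayTrade : ∀ {T₁ T₂ T₃} → Bitrade T₁ T₂ → Bitrade T₁ T₃ → Bitrade T₂ T₃ → ThreeWayTrade T₁ T₂ T₃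
threeWayTrade b₁₂ b₁₃ b₂₃ = b₁₂ , bitrade-sym b₁₂ , b₁₃ , bitrade-sym b₁₃ , b₂₃ , bitrade-sym b₂₃

module ThirdTrades {T₁ T₂} (bitrade : Bitrade T₁ T₂) (iso : ModelIsomorphism T₁ T₂) where
  open ModelIsomorphism iso

  thirdTrade : ∀ {M} → FamilyOn (_< 6) M → Bitrade modelT₁ M → Bitrade modelT₂ M →
               ThreeWayTrade T₁ T₂ (mapFamily (from σ) M)
  thirdTrade pM b₁ b₂ = threeWayTrade bitrade
    (bitrade-pullback σ (T₁-on bitrade) (proj₁ bitrade) σT₁≈modelT₁ modelT₁-on pM b₁)
    (bitrade-pullback σ (T₂-on bitrade) (proj₁ (proj₂ bitrade)) σT₂≈modelT₂ modelT₂-on pM b₂)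

  thirdTrades-distinct : ¬ SameFamily (mapFamily (from σ) modelT₃) (mapFamily (from σ) modelT₃′)
  thirdTrades-distinct same = modelT₃≉modelT₃′ (subst₂ SameFamily
    (mapFamily-from-to (inverse σ) modelT₃-on) (mapFamily-from-to (inverse σ) modelT₃′-on)
    (sameFamily-map (to σ) same))

  thirdTrade-unique : ∀ {T} → ThreeWayTrade T₁ T₂ T →
                      SameFamily T (mapFamily (from σ) modelT₃) ⊎ SameFamily T (mapFamily (from σ) modelT₃′)
  thirdTrade-unique {T} (_ , _ , b₁ , _ , _ , (_ , _ , T∉T₂ , _)) =
    Sum.map decode decode (All.lookup modelT₁-thirdTrades (proj₁ partner) (proj₂ partner) avoids)
    where
    pT : FamilyOn (VertexOf T₁) T
    pT = ⊆U⇒FamilyOn (bitrade-⊇U b₁)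
    partner : image σ T ∈ packingsOf modelT₁ × PartnerCandidate modelT₁ (image σ T)
    partner = image-partner σ (T₁-on bitrade) pT b₁ σT₁≈modelT₁
    avoids : All (λ C → ¬ C ∈C modelT₂) (image σ T)
    avoids = image-avoids σ pT (T₂-on bitrade) T∉T₂ σT₂≈modelT₂
    decode : ∀ {A} → CanonicallyEqual (image σ T) A → SameFamily T (mapFamily (from σ) A)
    decode σT≡A = sameFamily-transpose σ pT
      (sameFamily-trans (sameFamily-canonical _) (canonicallyEqual⇒sameFamily σT≡A))

mainTheorem4 :
    (Σ Family λ T₁ → Σ Family λ T₂ → Bitrade36 T₁ T₂) ×
    (∀ T₁ T₂ S₁ S₂ → Bitrade36 T₁ T₂ → Bitrade36 S₁ S₂ → Isomorphic T₁ T₂ S₁ S₂) ×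
    (∀ T₁ T₂ → Bitrade36 T₁ T₂ →
      Σ Family λ T₃ → Σ Family λ T₃′ →
        ThreeWayTrade T₁ T₂ T₃ × ThreeWayTrade T₁ T₂ T₃′ × ¬ SameFamily T₃ T₃′ ×
        (∀ T → ThreeWayTrade T₁ T₂ T → SameFamily T T₃ ⊎ SameFamily T T₃′))
mainTheorem4 =
  (modelT₁ , modelT₂ , modelBitrade₁₂ , refl , refl) ,
  (λ _ _ _ _ b b′ → isomorphic-via-model (proj₁ b′) (modelIsomorphism b) (modelIsomorphism b′)) ,
  λ _ _ b → let open ThirdTrades (proj₁ b) (modelIsomorphism b) in
    _ , _ ,
    thirdTrade modelT₃-on modelBitrade₁₃ modelBitrade₂₃ ,
    thirdTrade modelT₃′-on modelBitrade₁₃′ modelBitrade₂₃′ ,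
    thirdTrades-distinct ,
    λ _ → thirdTrade-unique
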